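{- Let $x^Z$ be an optimal solution of an instance of the incremental knapsack problem, with value $V^Z=\sum_{i,t}v_i\Delta_tx^Z_{i,t}$. Let $S=S(1/2)$ and let $t_{1/2}$ be a period with $\sum_{t=1}^{t_{1/2}-1}\Delta_t\le S\sum_{t=t_{1/2}}^T\Delta_t$ and $B_T-B_{t_{1/2}}\le B_T/2$. Let $1<t^{[3]}<T$ be a period such that $\frac13V^Z\le\sum_{t=t^{[3]}}^T\sum_iv_i\Delta_tx^Z_{i,t}$ and $\frac13V^Z\le\sum_{t=1}^{t^{[3]}-1}\sum_iv_i\Delta_tx^Z_{i,t}$. Suppose $t_{1/2}<t^{[3]}$. Then some feasible replicated-knapsack solution has value at least $V^Z/9$.
   Context: Incremental knapsack problem: $T$ periods with capacities $B_1\le\dots\le B_T$, discount factors $\Delta_t>0$, $N$ items with values $v_i>0$ and weights $w_i>0$; a feasible solution is $x\in\{0,1\}^{N\times T}$ with $x_{i,t-1}\le x_{i,t}$ ($t\ge2$) and $\sum_iw_ix_{i,t}\le B_t$; its value is $\sum_{t,i}v_i\Delta_tx_{i,t}$. $S(1/2)$ is the smallest $S\ge0$ for which there is a period $t'$ with $\sum_{t=1}^{t'-1}\Delta_t\le S\sum_{t=t'}^T\Delta_t$ and $B_T-B_{t'}\le B_T/2$. For $1\le\bar t\le T$, a 0-1 vector $\bar x$ is a replicated-knapsack solution at $\bar t$ if $\bar x_{i,t}=0$ for $t<\bar t$ and $\bar x_{i,t}=\bar x_{i,\bar t}$ for $t\ge\bar t$.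
   Formalization: The capacities, discount factors, item values and item weights, as well as the number S(1/2), are rational. -}

module Defs where

open import Data.Nat using (ℕ; zero; suc; _∸_) renaming (_≤_ to _≤ℕ_; _<_ to _<ℕ_)
open import Data.Fin using (Fin; zero; suc)
open import Data.Bool using (Bool; true; false; if_then_else_)
open import Data.Product using (_×_; ∃-syntax)
open import Data.Rational using (ℚ; 0ℚ; 1ℚ; ½; _+_; _*_; _-_; _≤_; _<_)
open import Relation.Binary.PropositionalEquality using (_≡_)

-- An instance of the incremental knapsack problem.
-- Periods are 1..T (values of B, Δ outside this range are irrelevant),
-- items are Fin N.
record Instance : Set where
  field
    T : ℕ
    N : ℕ
    B : ℕ → ℚ
    Δ : ℕ → ℚ
    v : Fin N → ℚ
    w : Fin N → ℚ

open Instance public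

record Valid (I : Instance) : Set where
  field
    B-mono : ∀ t → 1 ≤ℕ t → t <ℕ T I → B I t ≤ B I (suc t)
    Δ-pos  : ∀ t → 1 ≤ℕ t → t ≤ℕ T I → 0ℚ < Δ I t
    v-pos  : ∀ i → 0ℚ < v I i
    w-pos  : ∀ i → 0ℚ < w I i

Σᶠ : ∀ n → (Fin n → ℚ) → ℚ
Σᶠ zero    f = 0ℚ
Σᶠ (suc n) f = f zero + Σᶠ n (λ i → f (suc i))

-- Σᵗ a b f = Σ_{t=a}^{b} f t  (empty, i.e. 0, when b < a)
Σᵗ : ℕ → ℕ → (ℕ → ℚ) → ℚ
Σᵗ a b f = go a (suc b ∸ a)
  where
  go : ℕ → ℕ → ℚ
  go s zero    = 0ℚ
  go s (suc k) = f s + go (suc s) k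

⟦_⟧ : Bool → ℚ
⟦ b ⟧ = if b then 1ℚ else 0ℚ

Sol : Instance → Set
Sol I = Fin (N I) → ℕ → Bool

periodValue : (I : Instance) → Sol I → ℕ → ℚ
periodValue I x t = Σᶠ (N I) (λ i → v I i * Δ I t * ⟦ x i t ⟧)

value : (I : Instance) → Sol I → ℚ
value I x = Σᵗ 1 (T I) (periodValue I x)

Feasible : (I : Instance) → Sol I → Set
Feasible I x =
  (∀ i t → 2 ≤ℕ t → t ≤ℕ T I → x i (t ∸ 1) ≡ true → x i t ≡ true)
  × (∀ t → 1 ≤ℕ t → t ≤ℕ T I → Σᶠ (N I) (λ i → w I i * ⟦ x i t ⟧) ≤ B I t)

Optimal : (I : Instance) → Sol I → Set
Optimal I x = Feasible I x × (∀ y → Feasible I y → value I y ≤ value I x)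

Replicated : (I : Instance) → ℕ → Sol I → Set
Replicated I tb x =
  (∀ i t → 1 ≤ℕ t → t <ℕ tb → x i t ≡ false)
  × (∀ i t → tb ≤ℕ t → t ≤ℕ T I → x i t ≡ x i tb)

HalfCond : (I : Instance) → ℚ → ℕ → Set
HalfCond I S t' =
  1 ≤ℕ t' × t' ≤ℕ T I
  × Σᵗ 1 (t' ∸ 1) (Δ I) ≤ S * Σᵗ t' (T I) (Δ I)
  × B I (T I) - B I t' ≤ ½ * B I (T I)

IsS½ : Instance → ℚ → Set
IsS½ I S =
  0ℚ ≤ S × (∃[ t' ] HalfCond I S t')
  × (∀ S' → 0ℚ ≤ S' → ∃[ t' ] HalfCond I S' t' → S ≤ S')

module Submission where

-- Capacities grow, so B_{t3} ≥ B_{t½} ≥ B_T/2.  The items x^Z packs in the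
-- last period weigh at most B_T, so a greedy scan splits them into two parts P, Q
-- of weight at most B_T/2 ≤ B_{t3} each plus at most one leftover item k.
-- Packing P from t3 on, Q from t3 on, and k from the first period in which x^Z
-- packs it gives three feasible replicated solutions.  As x^Z never unpacks an
-- item, every item it packs in a period t ≥ t3 is in P or Q, or is k and already
-- packed by the third solution; hence the three together earn at least what x^Z
-- earns from t3 on, that is V^Z/3, and one of them earns V^Z/9.

open import Defs
open import Data.Nat using (ℕ; zero; suc; _∸_; _≤ᵇ_; _≤′_; ≤′-refl; ≤′-step; s≤s; z≤n; _≤?_)
  renaming (_≤_ to _≤ℕ_; _<_ to _<ℕ_)
import Data.Nat.Properties as ℕ
open import Data.Fin using (Fin; zero; suc)
open import Data.Bool using (Bool; true; false; _∧_)
open import Data.Bool.Properties using (∧-identityʳ; ∧-zeroʳ; ∧-conicalˡ; T-≡)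
open import Function.Bundles using (Equivalence)
open import Data.Product using (_×_; _,_; ∃-syntax; proj₂)
open import Data.Sum using (_⊎_; inj₁; inj₂)
open import Data.Empty using (⊥-elim)
open import Function using (case_of_; _∘_)
open import Data.Vec.Functional using (_∷_)
open import Data.Maybe using (Maybe; just; nothing)
open import Data.Integer using (+_)
open import Data.Rational using (ℚ; 0ℚ; 1ℚ; ½; _+_; _*_; _-_; -_; _≤_; _<_; _/_; nonNegative)
import Data.Rational.Properties as ℚ
open import Level using (0ℓ)
open import Relation.Binary.PropositionalEquality
open import Relation.Nullary using (yes; no)
open import Tactic.RingSolver using (solve-∀)
open import Tactic.RingSolver.Core.AlmostCommutativeRing using (AlmostCommutativeRing; fromCommutativeRing)

-- ℚ as a ring for the normalising tactic `solve-∀`; the zero test lets the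
-- normaliser drop monomials whose coefficients cancel.
ℚ-ring : AlmostCommutativeRing 0ℓ 0ℓ
ℚ-ring = fromCommutativeRing ℚ.+-*-commutativeRing is-zero
  where
  is-zero : ∀ x → Maybe (0ℚ ≡ x)
  is-zero x with 0ℚ ℚ.≟ x
  ... | yes 0≡x = just 0≡x
  ... | no _    = nothing

*-nonneg : ∀ {a b} → 0ℚ ≤ a → 0ℚ ≤ b → 0ℚ ≤ a * b
*-nonneg {a} 0≤a 0≤b =
  subst (_≤ a * _) (ℚ.*-zeroʳ a) (ℚ.*-monoˡ-≤-nonNeg a {{nonNegative 0≤a}} 0≤b)

≤-+-nonnegʳ : ∀ {x y} → 0ℚ ≤ y → x ≤ x + y
≤-+-nonnegʳ {x} 0≤y = subst (_≤ x + _) (ℚ.+-identityʳ x) (ℚ.+-monoʳ-≤ x 0≤y)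

≤-+-nonnegˡ : ∀ {x y} → 0ℚ ≤ y → x ≤ y + x
≤-+-nonnegˡ {x} {y} 0≤y = subst (_≤ y + x) (ℚ.+-identityˡ x) (ℚ.+-monoˡ-≤ x 0≤y)

⟦⟧-nonneg : ∀ b → 0ℚ ≤ ⟦ b ⟧
⟦⟧-nonneg true  = ℚ.<⇒≤ (ℚ.positive⁻¹ 1ℚ)
⟦⟧-nonneg false = ℚ.≤-refl

⟦⟧-scaled-nonneg : ∀ {c} → 0ℚ ≤ c → ∀ b → 0ℚ ≤ c * ⟦ b ⟧
⟦⟧-scaled-nonneg 0≤c b = *-nonneg 0≤c (⟦⟧-nonneg b)

⟦⟧-mono : ∀ {c} b b′ → 0ℚ ≤ c → (b ≡ true → b′ ≡ true) → c * ⟦ b ⟧ ≤ c * ⟦ b′ ⟧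
⟦⟧-mono {c} false b′ 0≤c _ = subst (_≤ c * ⟦ b′ ⟧) (sym (ℚ.*-zeroʳ c)) (⟦⟧-scaled-nonneg 0≤c b′)
⟦⟧-mono true b′ 0≤c b⇒b′ rewrite b⇒b′ refl = ℚ.≤-refl

⟦⟧-cover : ∀ {c} b p q r → 0ℚ ≤ c → (b ≡ true → p ≡ true ⊎ q ≡ true ⊎ r ≡ true)
         → c * ⟦ b ⟧ ≤ c * ⟦ p ⟧ + c * ⟦ q ⟧ + c * ⟦ r ⟧
⟦⟧-cover {c} false p q r 0≤c _ =
  subst (_≤ c * ⟦ p ⟧ + c * ⟦ q ⟧ + c * ⟦ r ⟧) (sym (ℚ.*-zeroʳ c))
    (ℚ.+-mono-≤ (ℚ.+-mono-≤ (⟦⟧-scaled-nonneg 0≤c p) (⟦⟧-scaled-nonneg 0≤c q)) (⟦⟧-scaled-nonneg 0≤c r))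
⟦⟧-cover {c} true p q r 0≤c forced with forced refl
... | inj₁ refl        = ℚ.≤-trans (≤-+-nonnegʳ (⟦⟧-scaled-nonneg 0≤c q))
                                  (≤-+-nonnegʳ (⟦⟧-scaled-nonneg 0≤c r))
... | inj₂ (inj₁ refl) = ℚ.≤-trans (≤-+-nonnegˡ (⟦⟧-scaled-nonneg 0≤c p))
                                  (≤-+-nonnegʳ (⟦⟧-scaled-nonneg 0≤c r))
... | inj₂ (inj₂ refl) = ≤-+-nonnegˡ (ℚ.+-mono-≤ (⟦⟧-scaled-nonneg 0≤c p) (⟦⟧-scaled-nonneg 0≤c q))

one-of-three : ∀ V a b c → (+ 1 / 3) * V ≤ a + b + c
             → (+ 1 / 9) * V ≤ a ⊎ (+ 1 / 9) * V ≤ b ⊎ (+ 1 / 9) * V ≤ c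
one-of-three V a b c V/3≤sum with (+ 1 / 9) * V ℚ.≤? a | (+ 1 / 9) * V ℚ.≤? b | (+ 1 / 9) * V ℚ.≤? c
... | yes V/9≤a | _ | _ = inj₁ V/9≤a
... | no _ | yes V/9≤b | _ = inj₂ (inj₁ V/9≤b)
... | no _ | no _ | yes V/9≤c = inj₂ (inj₂ V/9≤c)
... | no a<V/9 | no b<V/9 | no c<V/9 = ⊥-elim (ℚ.<-irrefl refl (begin-strict
  a + b + c
    <⟨ ℚ.+-mono-< (ℚ.+-mono-< (ℚ.≰⇒> a<V/9) (ℚ.≰⇒> b<V/9)) (ℚ.≰⇒> c<V/9) ⟩
  (+ 1 / 9) * V + (+ 1 / 9) * V + (+ 1 / 9) * V
    ≡⟨ three-ninths V ⟨
  (+ 1 / 3) * V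
    ≤⟨ V/3≤sum ⟩
  a + b + c ∎))
  where
  open ℚ.≤-Reasoning
  three-ninths : ∀ V → (+ 1 / 3) * V ≡ (+ 1 / 9) * V + (+ 1 / 9) * V + (+ 1 / 9) * V
  three-ninths = solve-∀ ℚ-ring

half-remains : ∀ C B′ → C - B′ ≤ ½ * C → ½ * C ≤ B′
half-remains C B′ drop≤half = begin
  ½ * C                   ≡⟨ half C B′ ⟩
  (B′ - ½ * C) + (C - B′) ≤⟨ ℚ.+-monoʳ-≤ (B′ - ½ * C) drop≤half ⟩
  (B′ - ½ * C) + ½ * C    ≡⟨ cancel C B′ ⟩
  B′                      ∎
  where
  open ℚ.≤-Reasoning
  half : ∀ C B′ → ½ * C ≡ (B′ - ½ * C) + (C - B′)
  half = solve-∀ ℚ-ring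
  cancel : ∀ C B′ → (B′ - ½ * C) + ½ * C ≡ B′
  cancel = solve-∀ ℚ-ring

sub-nonneg : ∀ {a p} → a ≤ p → 0ℚ ≤ p - a
sub-nonneg {a} {p} a≤p = subst (_≤ p - a) (ℚ.+-inverseʳ a) (ℚ.+-monoˡ-≤ (- a) a≤p)

rebudget : ∀ {a x p q} → a + x ≤ p + q → x ≤ (p - a) + q
rebudget {a} {x} {p} {q} a+x≤p+q = begin
  x               ≡⟨ cancelˡ a x ⟩
  (a + x) - a     ≤⟨ ℚ.+-monoˡ-≤ (- a) a+x≤p+q ⟩
  (p + q) - a     ≡⟨ regroup p q a ⟩
  (p - a) + q     ∎
  where
  open ℚ.≤-Reasoning
  cancelˡ : ∀ a x → x ≡ (a + x) - a
  cancelˡ = solve-∀ ℚ-ring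
  regroup : ∀ p q a → (p + q) - a ≡ (p - a) + q
  regroup = solve-∀ ℚ-ring

overflow-rest : ∀ {a x p q} → p < a → a + x ≤ p + q → x ≤ q
overflow-rest {a} {x} {p} {q} p<a a+x≤p+q with x ℚ.≤? q
... | yes x≤q = x≤q
... | no  x≰q = ⊥-elim (ℚ.<-irrefl refl (begin-strict
  p + q  ≡⟨ ℚ.+-comm p q ⟩
  q + p  <⟨ ℚ.+-mono-< (ℚ.≰⇒> x≰q) p<a ⟩
  x + a  ≡⟨ ℚ.+-comm x a ⟩
  a + x  ≤⟨ a+x≤p+q ⟩
  p + q  ∎))
  where open ℚ.≤-Reasoning

two-halves : ∀ C → C ≡ ½ * C + ½ * C
two-halves = solve-∀ ℚ-ring

Σᶠ-mono : ∀ n {f g : Fin n → ℚ} → (∀ i → f i ≤ g i) → Σᶠ n f ≤ Σᶠ n g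
Σᶠ-mono zero    f≤g = ℚ.≤-refl
Σᶠ-mono (suc n) f≤g = ℚ.+-mono-≤ (f≤g zero) (Σᶠ-mono n (λ i → f≤g (suc i)))

Σᶠ-nonneg : ∀ n {f : Fin n → ℚ} → (∀ i → 0ℚ ≤ f i) → 0ℚ ≤ Σᶠ n f
Σᶠ-nonneg zero    0≤f = ℚ.≤-refl
Σᶠ-nonneg (suc n) 0≤f = ℚ.+-mono-≤ (0≤f zero) (Σᶠ-nonneg n (λ i → 0≤f (suc i)))

Σᶠ-zero : ∀ n {f : Fin n → ℚ} → (∀ i → f i ≡ 0ℚ) → Σᶠ n f ≡ 0ℚ
Σᶠ-zero zero    f≡0 = refl
Σᶠ-zero (suc n) f≡0 rewrite f≡0 zero | Σᶠ-zero n (λ i → f≡0 (suc i)) = refl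

Σᶠ-+ : ∀ n (f g : Fin n → ℚ) → Σᶠ n (λ i → f i + g i) ≡ Σᶠ n f + Σᶠ n g
Σᶠ-+ zero    f g = refl
Σᶠ-+ (suc n) f g rewrite Σᶠ-+ n (λ i → f (suc i)) (λ i → g (suc i)) =
  interchange (f zero) (g zero) (Σᶠ n (λ i → f (suc i))) (Σᶠ n (λ i → g (suc i)))
  where
  interchange : ∀ a b c d → (a + b) + (c + d) ≡ (a + c) + (b + d)
  interchange = solve-∀ ℚ-ring

Σᵗ-empty : ∀ {a b} f → b <ℕ a → Σᵗ a b f ≡ 0ℚ
Σᵗ-empty {a} {b} f b<a with suc b ∸ a | ℕ.m≤n⇒m∸n≡0 b<a
... | .0 | refl = refl

Σᵗ-peel : ∀ {a b} f → a ≤ℕ b → Σᵗ a b f ≡ f a + Σᵗ (suc a) b f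
Σᵗ-peel {a} {b} f a≤b with suc b ∸ a | ℕ.+-∸-assoc 1 a≤b
... | .(suc (b ∸ a)) | refl = refl

range-induction : ∀ {ℓ} b (P : ℕ → Set ℓ) → (∀ a → b <ℕ a → P a)
                → (∀ a → a ≤ℕ b → P (suc a) → P a) → ∀ a → P a
range-induction b P empty step a = go (suc b ∸ a) a refl
  where
  go : ∀ n a → suc b ∸ a ≡ n → P a
  go zero    a len≡0 = empty a (ℕ.m∸n≡0⇒m≤n len≡0)
  go (suc n) a len≡n with a ≤? b
  ... | no  a≰b = empty a (ℕ.≰⇒> a≰b)
  ... | yes a≤b = step a a≤b (go n (suc a) (ℕ.suc-injective (trans (sym (ℕ.+-∸-assoc 1 a≤b)) len≡n)))

Σᵗ-mono : ∀ b (f g : ℕ → ℚ) a → (∀ t → a ≤ℕ t → t ≤ℕ b → f t ≤ g t) → Σᵗ a b f ≤ Σᵗ a b g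
Σᵗ-mono b f g = range-induction b _ empty step
  where
  empty : ∀ a → b <ℕ a → (∀ t → a ≤ℕ t → t ≤ℕ b → f t ≤ g t) → Σᵗ a b f ≤ Σᵗ a b g
  empty a b<a _ = ℚ.≤-reflexive (trans (Σᵗ-empty f b<a) (sym (Σᵗ-empty g b<a)))
  step : ∀ a → a ≤ℕ b → ((∀ t → suc a ≤ℕ t → t ≤ℕ b → f t ≤ g t) → Σᵗ (suc a) b f ≤ Σᵗ (suc a) b g)
       → (∀ t → a ≤ℕ t → t ≤ℕ b → f t ≤ g t) → Σᵗ a b f ≤ Σᵗ a b g
  step a a≤b rest f≤g rewrite Σᵗ-peel f a≤b | Σᵗ-peel g a≤b =
    ℚ.+-mono-≤ (f≤g a ℕ.≤-refl a≤b) (rest (λ t a<t → f≤g t (ℕ.<⇒≤ a<t)))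

Σᵗ-+ : ∀ b (f g : ℕ → ℚ) a → Σᵗ a b (λ t → f t + g t) ≡ Σᵗ a b f + Σᵗ a b g
Σᵗ-+ b f g = range-induction b _ empty step
  where
  empty : ∀ a → b <ℕ a → Σᵗ a b (λ t → f t + g t) ≡ Σᵗ a b f + Σᵗ a b g
  empty a b<a rewrite Σᵗ-empty (λ t → f t + g t) b<a | Σᵗ-empty f b<a | Σᵗ-empty g b<a = refl
  step : ∀ a → a ≤ℕ b → Σᵗ (suc a) b (λ t → f t + g t) ≡ Σᵗ (suc a) b f + Σᵗ (suc a) b g
       → Σᵗ a b (λ t → f t + g t) ≡ Σᵗ a b f + Σᵗ a b g
  step a a≤b rest rewrite Σᵗ-peel (λ t → f t + g t) a≤b | Σᵗ-peel f a≤b | Σᵗ-peel g a≤b | rest =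
    interchange (f a) (g a) (Σᵗ (suc a) b f) (Σᵗ (suc a) b g)
    where
    interchange : ∀ a b c d → (a + b) + (c + d) ≡ (a + c) + (b + d)
    interchange = solve-∀ ℚ-ring

Σᵗ-drop : ∀ {a b} g → 0ℚ ≤ g a → Σᵗ (suc a) b g ≤ Σᵗ a b g
Σᵗ-drop {a} {b} g 0≤ga with a ≤? b
... | yes a≤b = subst (Σᵗ (suc a) b g ≤_) (sym (Σᵗ-peel g a≤b)) (≤-+-nonnegˡ 0≤ga)
... | no  a≰b = ℚ.≤-reflexive (trans (Σᵗ-empty g (ℕ.m<n⇒m<1+n (ℕ.≰⇒> a≰b))) (sym (Σᵗ-empty g (ℕ.≰⇒> a≰b))))

Σᵗ-suffix : ∀ {a c b} g → a ≤′ c → (∀ t → a ≤ℕ t → t <ℕ c → 0ℚ ≤ g t) → Σᵗ c b g ≤ Σᵗ a b g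
Σᵗ-suffix g ≤′-refl _ = ℚ.≤-refl
Σᵗ-suffix {a} {suc c} g (≤′-step a≤′c) 0≤g =
  ℚ.≤-trans (Σᵗ-drop g (0≤g c (ℕ.≤′⇒≤ a≤′c) (ℕ.n<1+n c)))
            (Σᵗ-suffix g a≤′c (λ t a≤t t<c → 0≤g t a≤t (ℕ.m<n⇒m<1+n t<c)))

false≢true : false ≢ true
false≢true ()

least-witness : (p : ℕ → Bool) → ∀ n → p n ≡ true
              → ∃[ m ] (m ≤ℕ n × p m ≡ true × (∀ t → t <ℕ m → p t ≡ false))
least-witness p n pn with scan (suc n)
  where
  scan : ∀ k → (∀ t → t <ℕ k → p t ≡ false)
             ⊎ ∃[ m ] (m <ℕ k × p m ≡ true × (∀ t → t <ℕ m → p t ≡ false))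
  scan zero = inj₁ (λ _ ())
  scan (suc k) with scan k
  ... | inj₂ (m , m<k , pm , below) = inj₂ (m , ℕ.m<n⇒m<1+n m<k , pm , below)
  ... | inj₁ none-below with p k in pk
  ...   | true  = inj₂ (k , ℕ.n<1+n k , pk , none-below)
  ...   | false = inj₁ λ t t<1+k → case ℕ.m≤n⇒m<n∨m≡n (ℕ.≤-pred t<1+k) of λ
    { (inj₁ t<k) → none-below t t<k ; (inj₂ refl) → pk }
... | inj₁ none-below = ⊥-elim (false≢true (trans (sym (none-below n (ℕ.n<1+n n))) pn))
... | inj₂ (m , m<1+n , pm , below) = m , ℕ.≤-pred m<1+n , pm , below

first-true : (p : ℕ → Bool) → ∀ {u} → 1 ≤ℕ u → p u ≡ true
           → ∃[ s ] (1 ≤ℕ s × s ≤ℕ u × p s ≡ true × (∀ t → 1 ≤ℕ t → p t ≡ true → s ≤ℕ t))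
first-true p {suc u} _ pu with least-witness (p ∘ suc) u pu
... | m , m≤u , p[1+m] , before = suc m , s≤s z≤n , s≤s m≤u , p[1+m] , after
  where
  after : ∀ t → 1 ≤ℕ t → p t ≡ true → suc m ≤ℕ t
  after (suc t) _ pt = s≤s (ℕ.≮⇒≥ (λ t<m → false≢true (trans (sym (before t t<m)) pt)))

weight : ∀ {n} → (Fin n → ℚ) → (Fin n → Bool) → ℚ
weight {n} w A = Σᶠ n (λ i → w i * ⟦ A i ⟧)

weight-nonneg : ∀ {n} {w : Fin n → ℚ} → (∀ i → 0ℚ ≤ w i) → ∀ A → 0ℚ ≤ weight w A
weight-nonneg {n} 0≤w A = Σᶠ-nonneg n (λ i → ⟦⟧-scaled-nonneg (0≤w i) (A i))

weight-mono : ∀ {n} {w : Fin n → ℚ} → (∀ i → 0ℚ ≤ w i) → ∀ {A A′}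
            → (∀ i → A i ≡ true → A′ i ≡ true) → weight w A ≤ weight w A′
weight-mono {n} 0≤w {A} {A′} A⊆A′ = Σᶠ-mono n (λ i → ⟦⟧-mono (A i) (A′ i) (0≤w i) (A⊆A′ i))

weight-empty : ∀ {n} (w : Fin n → ℚ) {A} → (∀ i → A i ≡ false) → weight w A ≡ 0ℚ
weight-empty {n} w A-empty = Σᶠ-zero n (λ i → trans (cong (λ b → w i * ⟦ b ⟧) (A-empty i)) (ℚ.*-zeroʳ (w i)))

weight-skip : ∀ {n} (w : Fin (suc n) → ℚ) A → weight w (false ∷ A) ≡ weight (w ∘ suc) A
weight-skip w A = trans (cong (_+ weight (w ∘ suc) A) (ℚ.*-zeroʳ (w zero))) (ℚ.+-identityˡ _)

weight-take : ∀ {n} (w : Fin (suc n) → ℚ) A → weight w (true ∷ A) ≡ w zero + weight (w ∘ suc) A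
weight-take w A = cong (_+ weight (w ∘ suc) A) (ℚ.*-identityʳ (w zero))

data AtMostOne {n} (X K : Fin n → Bool) : Set where
  no-item  : (∀ i → K i ≡ false) → AtMostOne X K
  one-item : ∀ k → X k ≡ true → (∀ i → K i ≡ true → i ≡ k) → AtMostOne X K

AtMostOne-skip : ∀ {n} {X : Fin (suc n) → Bool} {K} → AtMostOne (X ∘ suc) K → AtMostOne X (false ∷ K)
AtMostOne-skip (no-item K-empty)     = no-item λ { zero → refl ; (suc i) → K-empty i }
AtMostOne-skip (one-item k Xk only-k) = one-item (suc k) Xk λ { zero () ; (suc i) Ki → cong suc (only-k i Ki) }

record Split {n} (w : Fin n → ℚ) (X : Fin n → Bool) (p q : ℚ) : Set where
  field
    P Q K   : Fin n → Bool
    P-fits  : weight w P ≤ p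
    Q-fits  : weight w Q ≤ q
    covers  : ∀ i → X i ≡ true → P i ≡ true ⊎ Q i ≡ true ⊎ K i ≡ true
    K-small : AtMostOne X K

skip-first : ∀ {n} {w : Fin (suc n) → ℚ} {X p q} → X zero ≡ false
           → Split (w ∘ suc) (X ∘ suc) p q → Split w X p q
skip-first {w = w} X₀≡false s = record
  { P = false ∷ P ; Q = false ∷ Q ; K = false ∷ K
  ; P-fits = subst (_≤ _) (sym (weight-skip w P)) P-fits
  ; Q-fits = subst (_≤ _) (sym (weight-skip w Q)) Q-fits
  ; covers = λ { zero X₀ → ⊥-elim (false≢true (trans (sym X₀≡false) X₀)) ; (suc i) → covers i }
  ; K-small = AtMostOne-skip K-small }
  where open Split s

take-first : ∀ {n} {w : Fin (suc n) → ℚ} {X p q}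
           → Split (w ∘ suc) (X ∘ suc) (p - w zero) q → Split w X p q
take-first {w = w} {p = p} s = record
  { P = true ∷ P ; Q = false ∷ Q ; K = false ∷ K
  ; P-fits = begin
      weight w (true ∷ P)          ≡⟨ weight-take w P ⟩
      w zero + weight (w ∘ suc) P  ≤⟨ ℚ.+-monoʳ-≤ (w zero) P-fits ⟩
      w zero + (p - w zero)        ≡⟨ add-sub (w zero) p ⟩
      p                            ∎
  ; Q-fits = subst (_≤ _) (sym (weight-skip w Q)) Q-fits
  ; covers = λ { zero _ → inj₁ refl ; (suc i) → covers i }
  ; K-small = AtMostOne-skip K-small }
  where
  open Split s
  open ℚ.≤-Reasoning
  add-sub : ∀ a p → a + (p - a) ≡ p
  add-sub = solve-∀ ℚ-ring

overflow-first : ∀ {n} {w : Fin (suc n) → ℚ} {X p q} → X zero ≡ true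
               → 0ℚ ≤ p → weight (w ∘ suc) (X ∘ suc) ≤ q → Split w X p q
overflow-first {w = w} {X} X₀≡true 0≤p tail-fits = record
  { P = λ _ → false ; Q = false ∷ X ∘ suc ; K = true ∷ λ _ → false
  ; P-fits = subst (_≤ _) (sym (weight-empty w (λ _ → refl))) 0≤p
  ; Q-fits = subst (_≤ _) (sym (weight-skip w (X ∘ suc))) tail-fits
  ; covers = λ { zero _ → inj₂ (inj₂ refl) ; (suc i) Xi → inj₂ (inj₁ Xi) }
  ; K-small = one-item zero X₀≡true λ { zero _ → refl ; (suc i) () } }

-- If the nonnegative weights of X total at most p + q, put
-- the items of X into P in order while P stays within p; the first item that
-- does not fit becomes the extra item K, and the rest of X, weighing less than
-- what remains of p + q after that item, i.e. less than q, forms Q.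
split : ∀ {n} (w : Fin n → ℚ) (X : Fin n → Bool) {p q} → (∀ i → 0ℚ ≤ w i)
      → 0ℚ ≤ p → 0ℚ ≤ q → weight w X ≤ p + q → Split w X p q
split {zero} w X _ 0≤p 0≤q _ = record
  { P = λ () ; Q = λ () ; K = λ () ; P-fits = 0≤p ; Q-fits = 0≤q
  ; covers = λ () ; K-small = no-item λ () }
split {suc n} w X {p} {q} 0≤w 0≤p 0≤q X-fits with X zero in X₀ | w zero ℚ.≤? p
... | false | _ = skip-first X₀
  (split (w ∘ suc) (X ∘ suc) (0≤w ∘ suc) 0≤p 0≤q (subst (_≤ p + q) (weight-skip w (X ∘ suc)) X-fits))
... | true | yes w₀≤p = take-first
  (split (w ∘ suc) (X ∘ suc) (0≤w ∘ suc) (sub-nonneg w₀≤p) 0≤q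
         (rebudget {w zero} {p = p} (subst (_≤ p + q) (weight-take w (X ∘ suc)) X-fits)))
... | true | no w₀≰p = overflow-first X₀ 0≤p
  (overflow-rest (ℚ.≰⇒> w₀≰p) (subst (_≤ p + q) (weight-take w (X ∘ suc)) X-fits))

module Knapsack (I : Instance) (valid : Valid I) where
  open Valid valid

  w-nonneg : ∀ i → 0ℚ ≤ w I i
  w-nonneg i = ℚ.<⇒≤ (w-pos i)

  B-mono-range : ∀ {s t} → 1 ≤ℕ s → s ≤ℕ t → t ≤ℕ T I → B I s ≤ B I t
  B-mono-range {s} 1≤s s≤t = grow (ℕ.≤⇒≤′ s≤t)
    where
    grow : ∀ {t} → s ≤′ t → t ≤ℕ T I → B I s ≤ B I t
    grow ≤′-refl _ = ℚ.≤-refl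
    grow (≤′-step {t} s≤′t) t<T =
      ℚ.≤-trans (grow s≤′t (ℕ.<⇒≤ t<T)) (B-mono t (ℕ.≤-trans 1≤s (ℕ.≤′⇒≤ s≤′t)) t<T)

  persists : ∀ {x} → Feasible I x → ∀ i {s t} → 1 ≤ℕ s → s ≤ℕ t → t ≤ℕ T I → x i s ≡ true → x i t ≡ true
  persists {x} (stays , _) i {s} 1≤s s≤t t≤T xis = grow (ℕ.≤⇒≤′ s≤t) t≤T
    where
    grow : ∀ {t} → s ≤′ t → t ≤ℕ T I → x i t ≡ true
    grow ≤′-refl _ = xis
    grow (≤′-step {t} s≤′t) t<T =
      stays i (suc t) (s≤s (ℕ.≤-trans 1≤s (ℕ.≤′⇒≤ s≤′t))) t<T (grow s≤′t (ℕ.<⇒≤ t<T))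

  capacity-nonneg : ∀ {x} → Feasible I x → ∀ t → 1 ≤ℕ t → t ≤ℕ T I → 0ℚ ≤ B I t
  capacity-nonneg {x} (_ , fits) t 1≤t t≤T = ℚ.≤-trans (weight-nonneg w-nonneg (λ i → x i t)) (fits t 1≤t t≤T)

  replicate : ℕ → (Fin (N I) → Bool) → Sol I
  replicate s A i t = A i ∧ (s ≤ᵇ t)

  replicate-started : ∀ {s t} A i → s ≤ℕ t → replicate s A i t ≡ A i
  replicate-started A i s≤t =
    trans (cong (A i ∧_) (Equivalence.to T-≡ (ℕ.≤⇒≤ᵇ s≤t))) (∧-identityʳ (A i))

  replicate-waiting : ∀ {s t} A i → t <ℕ s → replicate s A i t ≡ false
  replicate-waiting {s} {t} A i t<s with s ≤ᵇ t in s≤ᵇt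
  ... | false = ∧-zeroʳ (A i)
  ... | true  = ⊥-elim (ℕ.<⇒≱ t<s (ℕ.≤ᵇ⇒≤ s t (Equivalence.from T-≡ s≤ᵇt)))

  ReplicatedFeasible : ℕ → Sol I → Set
  ReplicatedFeasible s x = 1 ≤ℕ s × s ≤ℕ T I × Replicated I s x × Feasible I x

  replicate-feasible : (∀ t → 1 ≤ℕ t → t ≤ℕ T I → 0ℚ ≤ B I t)
                     → ∀ {s} A → 1 ≤ℕ s → s ≤ℕ T I → weight (w I) A ≤ B I s
                     → ReplicatedFeasible s (replicate s A)
  replicate-feasible 0≤B {s} A 1≤s s≤T A-fits = 1≤s , s≤T , (waiting , constant) , (stays , fits)
    where
    waiting : ∀ i t → 1 ≤ℕ t → t <ℕ s → replicate s A i t ≡ false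
    waiting i t _ = replicate-waiting A i
    constant : ∀ i t → s ≤ℕ t → t ≤ℕ T I → replicate s A i t ≡ replicate s A i s
    constant i t s≤t _ = trans (replicate-started A i s≤t) (sym (replicate-started {s} A i ℕ.≤-refl))
    stays : ∀ i t → 2 ≤ℕ t → t ≤ℕ T I → replicate s A i (t ∸ 1) ≡ true → replicate s A i t ≡ true
    stays i t _ _ packed with s ≤? t
    ... | yes s≤t = trans (replicate-started A i s≤t) (∧-conicalˡ (A i) _ packed)
    ... | no  s≰t = ⊥-elim (false≢true (trans (sym (replicate-waiting A i
                      (ℕ.≤-<-trans (ℕ.m∸n≤m t 1) (ℕ.≰⇒> s≰t)))) packed))
    fits : ∀ t → 1 ≤ℕ t → t ≤ℕ T I → weight (w I) (λ i → replicate s A i t) ≤ B I t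
    fits t 1≤t t≤T with s ≤? t
    ... | yes s≤t = begin
      weight (w I) (λ i → replicate s A i t) ≤⟨ weight-mono w-nonneg (λ i → ∧-conicalˡ (A i) _) ⟩
      weight (w I) A                          ≤⟨ A-fits ⟩
      B I s                                   ≤⟨ B-mono-range 1≤s s≤t t≤T ⟩
      B I t                                   ∎
      where open ℚ.≤-Reasoning
    ... | no  s≰t = subst (_≤ B I t) (sym (weight-empty (w I) (λ i → replicate-waiting A i (ℕ.≰⇒> s≰t))))
                      (0≤B t 1≤t t≤T)

  vΔ-nonneg : ∀ i t → 1 ≤ℕ t → t ≤ℕ T I → 0ℚ ≤ v I i * Δ I t
  vΔ-nonneg i t 1≤t t≤T = *-nonneg (ℚ.<⇒≤ (v-pos i)) (ℚ.<⇒≤ (Δ-pos t 1≤t t≤T))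

  periodValue-nonneg : ∀ x t → 1 ≤ℕ t → t ≤ℕ T I → 0ℚ ≤ periodValue I x t
  periodValue-nonneg x t 1≤t t≤T = Σᶠ-nonneg (N I) (λ i → ⟦⟧-scaled-nonneg (vΔ-nonneg i t 1≤t t≤T) (x i t))

  periodValue-cover : ∀ x y₁ y₂ y₃ t → 1 ≤ℕ t → t ≤ℕ T I
                    → (∀ i → x i t ≡ true → y₁ i t ≡ true ⊎ y₂ i t ≡ true ⊎ y₃ i t ≡ true)
                    → periodValue I x t ≤ periodValue I y₁ t + periodValue I y₂ t + periodValue I y₃ t
  periodValue-cover x y₁ y₂ y₃ t 1≤t t≤T covered = begin
    periodValue I x t
      ≤⟨ Σᶠ-mono (N I) (λ i → ⟦⟧-cover (x i t) (y₁ i t) (y₂ i t) (y₃ i t) (vΔ-nonneg i t 1≤t t≤T) (covered i)) ⟩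
    Σᶠ (N I) (λ i → term y₁ i + term y₂ i + term y₃ i)
      ≡⟨ Σᶠ-+ (N I) (λ i → term y₁ i + term y₂ i) (term y₃) ⟩
    Σᶠ (N I) (λ i → term y₁ i + term y₂ i) + periodValue I y₃ t
      ≡⟨ cong (_+ periodValue I y₃ t) (Σᶠ-+ (N I) (term y₁) (term y₂)) ⟩
    periodValue I y₁ t + periodValue I y₂ t + periodValue I y₃ t ∎
    where
    open ℚ.≤-Reasoning
    term : Sol I → Fin (N I) → ℚ
    term y i = v I i * Δ I t * ⟦ y i t ⟧

  value-from : ∀ y {a} → 1 ≤ℕ a → a ≤ℕ suc (T I) → Σᵗ a (T I) (periodValue I y) ≤ value I y
  value-from y 1≤a a≤1+T = Σᵗ-suffix (periodValue I y) (ℕ.≤⇒≤′ 1≤a)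
    (λ t 1≤t t<a → periodValue-nonneg y t 1≤t (ℕ.≤-pred (ℕ.≤-trans t<a a≤1+T)))

  value-from-cover : ∀ x y₁ y₂ y₃ {a} → 1 ≤ℕ a → a ≤ℕ T I
                   → (∀ t → a ≤ℕ t → t ≤ℕ T I → ∀ i → x i t ≡ true
                        → y₁ i t ≡ true ⊎ y₂ i t ≡ true ⊎ y₃ i t ≡ true)
                   → Σᵗ a (T I) (periodValue I x) ≤ value I y₁ + value I y₂ + value I y₃
  value-from-cover x y₁ y₂ y₃ {a} 1≤a a≤T covered = begin
    Σᵗ a (T I) (periodValue I x)
      ≤⟨ Σᵗ-mono (T I) _ _ a (λ t a≤t t≤T →
           periodValue-cover x y₁ y₂ y₃ t (ℕ.≤-trans 1≤a a≤t) t≤T (covered t a≤t t≤T)) ⟩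
    Σᵗ a (T I) (λ t → pv y₁ t + pv y₂ t + pv y₃ t)
      ≡⟨ Σᵗ-+ (T I) (λ t → pv y₁ t + pv y₂ t) (pv y₃) a ⟩
    Σᵗ a (T I) (λ t → pv y₁ t + pv y₂ t) + Σᵗ a (T I) (pv y₃)
      ≡⟨ cong (_+ Σᵗ a (T I) (pv y₃)) (Σᵗ-+ (T I) (pv y₁) (pv y₂) a) ⟩
    Σᵗ a (T I) (pv y₁) + Σᵗ a (T I) (pv y₂) + Σᵗ a (T I) (pv y₃)
      ≤⟨ ℚ.+-mono-≤ (ℚ.+-mono-≤ (from y₁) (from y₂)) (from y₃) ⟩
    value I y₁ + value I y₂ + value I y₃ ∎
    where
    open ℚ.≤-Reasoning
    pv : Sol I → ℕ → ℚ
    pv = periodValue I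
    from : ∀ y → Σᵗ a (T I) (pv y) ≤ value I y
    from y = value-from y 1≤a (ℕ.m≤n⇒m≤1+n a≤T)

  record Arrival (x : Sol I) (K : Fin (N I) → Bool) : Set where
    field
      s          : ℕ
      1≤s        : 1 ≤ℕ s
      s≤T        : s ≤ℕ T I
      packed     : ∀ i → K i ≡ true → x i s ≡ true
      not-before : ∀ i t → K i ≡ true → 1 ≤ℕ t → x i t ≡ true → s ≤ℕ t

  arrival : ∀ x {K} → 1 ≤ℕ T I → AtMostOne (λ i → x i (T I)) K → Arrival x K
  arrival x {K} 1≤T (no-item K-empty) = record
    { s = T I ; 1≤s = 1≤T ; s≤T = ℕ.≤-refl
    ; packed = λ i Ki → ⊥-elim (absent i Ki) ; not-before = λ i _ Ki → ⊥-elim (absent i Ki) }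
    where
    absent : ∀ i → K i ≢ true
    absent i Ki = false≢true (trans (sym (K-empty i)) Ki)
  arrival x 1≤T (one-item k xkT only-k) with first-true (x k) 1≤T xkT
  ... | s , 1≤s , s≤T , xks , first = record
    { s = s ; 1≤s = 1≤s ; s≤T = s≤T
    ; packed = λ i Ki → subst (λ j → x j s ≡ true) (sym (only-k i Ki)) xks
    ; not-before = λ i t Ki → subst (λ j → 1 ≤ℕ t → x j t ≡ true → s ≤ℕ t) (sym (only-k i Ki)) (first t) }

  NinthReplicated : ℚ → Set
  NinthReplicated V = ∃[ tb ] ∃[ xb ] (1 ≤ℕ tb × tb ≤ℕ T I × Replicated I tb xb × Feasible I xb
                                        × (+ 1 / 9) * V ≤ value I xb)

  achieves : ∀ {V s y} → ReplicatedFeasible s y → (+ 1 / 9) * V ≤ value I y → NinthReplicated V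
  achieves (1≤s , s≤T , replicated , feasible) worth = _ , _ , 1≤s , s≤T , replicated , feasible , worth

  ninth-of-three : ∀ {V s₁ s₂ s₃ y₁ y₂ y₃} → ReplicatedFeasible s₁ y₁ → ReplicatedFeasible s₂ y₂
                 → ReplicatedFeasible s₃ y₃ → (+ 1 / 3) * V ≤ value I y₁ + value I y₂ + value I y₃
                 → NinthReplicated V
  ninth-of-three {V} rf₁ rf₂ rf₃ third with one-of-three V _ _ _ third
  ... | inj₁ worth₁        = achieves {V} rf₁ worth₁
  ... | inj₂ (inj₁ worth₂) = achieves {V} rf₂ worth₂
  ... | inj₂ (inj₂ worth₃) = achieves {V} rf₃ worth₃

  -- P and
  -- Q packed from a on, and the extra item packed from its arrival in x, are
  -- feasible replicated solutions covering everything x packs from a on; so if x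
  -- earns a third of its value from a on, one of them earns a ninth of it.
  ninth-from-split : ∀ {x a h} → Feasible I x → 1 ≤ℕ a → a ≤ℕ T I → h ≤ B I a
                   → Split (w I) (λ i → x i (T I)) h h
                   → (+ 1 / 3) * value I x ≤ Σᵗ a (T I) (periodValue I x)
                   → NinthReplicated (value I x)
  ninth-from-split {x} {a} feasible 1≤a a≤T h≤Ba parts late =
    ninth-of-three {value I x} (replicate-feasible 0≤B P 1≤a a≤T (ℚ.≤-trans P-fits h≤Ba))
                               (replicate-feasible 0≤B Q 1≤a a≤T (ℚ.≤-trans Q-fits h≤Ba))
                               (replicate-feasible 0≤B K 1≤s s≤T K-fits)
                               (ℚ.≤-trans late (value-from-cover x _ _ _ 1≤a a≤T covered))
    where
    open Split parts
    open Arrival (arrival x (ℕ.≤-trans 1≤a a≤T) K-small)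
    0≤B : ∀ t → 1 ≤ℕ t → t ≤ℕ T I → 0ℚ ≤ B I t
    0≤B = capacity-nonneg feasible
    K-fits : weight (w I) K ≤ B I s
    K-fits = ℚ.≤-trans (weight-mono w-nonneg packed) (proj₂ feasible s 1≤s s≤T)
    covered : ∀ t → a ≤ℕ t → t ≤ℕ T I → ∀ i → x i t ≡ true
            → replicate a P i t ≡ true ⊎ replicate a Q i t ≡ true ⊎ replicate s K i t ≡ true
    covered t a≤t t≤T i xit with covers i (persists feasible i (ℕ.≤-trans 1≤a a≤t) t≤T ℕ.≤-refl xit)
    ... | inj₁ Pi        = inj₁ (trans (replicate-started P i a≤t) Pi)
    ... | inj₂ (inj₁ Qi) = inj₂ (inj₁ (trans (replicate-started Q i a≤t) Qi))
    ... | inj₂ (inj₂ Ki) =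
      inj₂ (inj₂ (trans (replicate-started K i (not-before i t Ki (ℕ.≤-trans 1≤a a≤t) xit)) Ki))

lemma5 : (I : Instance) → Valid I
    → (xZ : Sol I) → Optimal I xZ
    → (S : ℚ) → IsS½ I S
    → (t½ : ℕ) → HalfCond I S t½
    → (t3 : ℕ) → 1 <ℕ t3 → t3 <ℕ T I
    → (+ 1 / 3) * value I xZ ≤ Σᵗ t3 (T I) (periodValue I xZ)
    → (+ 1 / 3) * value I xZ ≤ Σᵗ 1 (t3 ∸ 1) (periodValue I xZ)
    → t½ <ℕ t3
    → ∃[ tb ] ∃[ xb ] (1 ≤ℕ tb × tb ≤ℕ T I × Replicated I tb xb × Feasible I xb
                        × (+ 1 / 9) * value I xZ ≤ value I xb)
lemma5 I valid xZ (feasible , _) S _ t½ (1≤t½ , _ , _ , capacity-drop) t3 1<t3 t3<T late _ t½<t3 =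
  ninth-from-split feasible 1≤t3 t3≤T half≤B[t3] halves late
  where
  open Knapsack I valid
  1≤t3 = ℕ.<⇒≤ 1<t3
  t3≤T = ℕ.<⇒≤ t3<T
  1≤T  = ℕ.≤-trans 1≤t3 t3≤T
  half = ½ * B I (T I)
  -- B_{t½} is at least half the final capacity, hence so is B_{t3}
  half≤B[t3] : half ≤ B I t3
  half≤B[t3] = ℚ.≤-trans (half-remains (B I (T I)) _ capacity-drop) (B-mono-range 1≤t½ (ℕ.<⇒≤ t½<t3) t3≤T)
  0≤half : 0ℚ ≤ half
  0≤half = *-nonneg (ℚ.<⇒≤ (ℚ.positive⁻¹ ½)) (capacity-nonneg feasible (T I) 1≤T ℕ.≤-refl)
  -- the final packing weighs at most B_T = half + half
  halves : Split (w I) (λ i → xZ i (T I)) half half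
  halves = split (w I) _ w-nonneg 0≤half 0≤half
             (subst (_ ≤_) (two-halves (B I (T I))) (proj₂ feasible (T I) 1≤T ℕ.≤-refl))
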